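{- Let $G=(K\cup I,E)$ be a split graph and let $L\subseteq K$ and $J\subseteq I$ (possibly empty). Then $L\cup J$ is free in the vertex shelling antimatroid of $G$ if and only if either there is no edge between $L$ and $J$, or there exists a vertex $h\in J$ such that $L\subseteq N(h)$ and $N(J\setminus\{h\})\subseteq N(h)\setminus L$.
   Context: All graphs are finite and simple. A split graph $G=(K\cup I,E)$ has vertex set $V=K\cup I$ partitioned into a clique $K$ and an independent set $I$. For $S\subseteq V$, $N(S)$ is the set of vertices of $V\setminus S$ adjacent to some vertex of $S$; $N(v)=N(\{v\})$. A vertex is simplicial if its neighbours induce a clique. The vertex shelling antimatroid $(V,\mathcal{F})$ of $G$: $F\subseteq V$ is feasible iff there is an ordering $(f_1,\dots,f_{|F|})$ of $F$ such that each $f_j$ is simplicial in $G\setminus\{f_1,\dots,f_{j-1}\}$. A subset $X\subseteq V$ is free if $\{F\cap X: F\in\mathcal{F}\}=2^X$. -}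

module Defs where

open import Data.Nat using (ℕ)
open import Data.Bool using (Bool; true; false)
open import Data.Fin using (Fin)
open import Data.Fin.Subset using (Subset; _∈_; _∉_; _⊆_; _∩_; _∪_; _─_; _-_; ⁅_⁆; ⊥)
open import Data.List using (List; []; _∷_)
import Data.List.Membership.Propositional as LM
open import Data.Product using (Σ; ∃; ∃-syntax; _×_; _,_)
open import Data.Sum using (_⊎_)
open import Relation.Binary.PropositionalEquality using (_≡_; _≢_)
open import Relation.Nullary using (¬_)
open import Function.Bundles using (_⇔_)

record Graph (n : ℕ) : Set where
  field
    adj     : Fin n → Fin n → Bool
    symm    : ∀ u v → adj u v ≡ adj v u
    irrefl  : ∀ v → adj v v ≡ false

open Graph public

Adj : ∀ {n} → Graph n → Fin n → Fin n → Set
Adj G u v = adj G u v ≡ true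

record IsSplit {n : ℕ} (G : Graph n) (K I : Subset n) : Set where
  field
    cover     : ∀ v → v ∈ K ⊎ v ∈ I
    disjoint  : ∀ v → v ∈ K → v ∉ I
    clique    : ∀ u v → u ∈ K → v ∈ K → u ≢ v → Adj G u v
    indep     : ∀ u v → u ∈ I → v ∈ I → ¬ Adj G u v

-- v is simplicial in G ∖ R (R = set of deleted vertices).
SimplicialIn : ∀ {n} → Graph n → Subset n → Fin n → Set
SimplicialIn G R v =
  v ∉ R × (∀ u w → u ∉ R → w ∉ R → u ≢ w → Adj G v u → Adj G v w → Adj G u w)

data ShellFrom {n : ℕ} (G : Graph n) : Subset n → List (Fin n) → Set where
  done : ∀ {R} → ShellFrom G R []
  step : ∀ {R v vs} → SimplicialIn G R v → ShellFrom G (R ∪ ⁅ v ⁆) vs →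
         ShellFrom G R (v ∷ vs)

Feasible : ∀ {n} → Graph n → Subset n → Set
Feasible G F = ∃[ fs ] (ShellFrom G ⊥ fs × (∀ x → (x ∈ F) ⇔ (x LM.∈ fs)))

Free : ∀ {n} → Graph n → Subset n → Set
Free G X = ∀ Y → Y ⊆ X → ∃[ F ] (Feasible G F × F ∩ X ≡ Y)

InN : ∀ {n} → Graph n → Subset n → Fin n → Set
InN G S x = x ∉ S × ∃[ s ] (s ∈ S × Adj G x s)

InNv : ∀ {n} → Graph n → Fin n → Fin n → Set
InNv G h x = InN G ⁅ h ⁆ x

NoEdgeBetween : ∀ {n} → Graph n → Subset n → Subset n → Set
NoEdgeBetween G L J = ∀ l j → l ∈ L → j ∈ J → ¬ Adj G l j

GoodVertex : ∀ {n} → Graph n → Subset n → Subset n → Set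
GoodVertex G L J = ∃[ h ] (h ∈ J
  × (∀ x → x ∈ L → InNv G h x)
  × (∀ x → InN G (J - h) x → InNv G h x × x ∉ L))

module Submission where

-- Sufficiency is a construction.  Given Y ⊆ L ∪ J we shell, in three rounds,
-- (1) every I-vertex not in J ∖ Y (an I-vertex is always simplicial: its
-- neighbours lie in the clique K), (2) in the good-vertex case, every
-- K-vertex not adjacent to h, and (3) the vertices of L ∩ Y.  The
-- hypotheses make each vertex simplicial when it is shelled, and the feasible
-- set obtained meets L ∪ J exactly in Y.
--
-- Necessity rests on `earlyWitness`: if X is free and x₀ ∈ X has property P,
-- then some P-vertex is simplicial at a stage where no vertex of X and no
-- P-vertex has been deleted (shell a feasible F with F ∩ X = {x₀} up to its
-- first P-vertex).  Three choices of P show that the J-endpoint h of an L–J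
-- edge is a good vertex.

open import Defs
open import Data.Nat using (ℕ)
open import Data.Fin using (Fin)
open import Data.Fin.Properties using (_≟_; any?)
open import Data.Fin.Subset using (Subset; _⊆_; _∪_; _∩_; _∈_; _∉_; _─_; _-_; ⁅_⁆; ⊥; inside)
open import Data.Fin.Subset.Properties
  using (_∈?_; x∈⁅x⁆; x∈⁅y⁆⇒x≡y; x≢y⇒x∉⁅y⁆; x∈p∪q⁻; x∈p∪q⁺; p⊆p∪q; x∈p∩q⁺; x∈p∩q⁻; ⊆-antisym; ∉⊥; p─q⊆p; x∈p∧x≢y⇒x∈p-y)
open import Data.Bool using (true)
open import Data.Bool.Properties using () renaming (_≟_ to _≟ᵇ_)
open import Data.List using (List; []; _∷_; _++_; allFin)
import Data.List.Membership.Propositional as List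
open import Data.List.Membership.Propositional.Properties using (∈-allFin)
open import Data.List.Relation.Unary.Any using (here; there)
import Data.Vec.Base as Vec
open import Data.Product using (∃-syntax; _×_; _,_; proj₁; proj₂)
open import Data.Sum using (_⊎_; inj₁; inj₂)
open import Data.Empty using (⊥-elim) renaming (⊥ to Empty)
open import Relation.Nullary using (¬_; Dec; yes; no)
open import Relation.Nullary.Decidable using (_×-dec_; _⊎-dec_; ¬?; decidable-stable)
open import Relation.Unary using (Decidable)
open import Relation.Binary.PropositionalEquality using (_≡_; _≢_; refl; sym; trans; subst)
open import Function.Bundles using (_⇔_; mk⇔; Equivalence)

x∈p─q⇒x∉q : ∀ {n} {x : Fin n} (p q : Subset n) → x ∈ p ─ q → x ∉ q
x∈p─q⇒x∉q (_ Vec.∷ p) (inside Vec.∷ q) () Vec.here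
x∈p─q⇒x∉q (_ Vec.∷ p) (_ Vec.∷ q) (Vec.there x∈p─q) (Vec.there x∈q) = x∈p─q⇒x∉q p q x∈p─q x∈q

x∈p-y⁻ : ∀ {n} {x y : Fin n} (p : Subset n) → x ∈ p - y → x ∈ p × x ≢ y
x∈p-y⁻ {y = y} p x∈p-y =
  p─q⊆p p ⁅ y ⁆ x∈p-y , λ { refl → x∈p─q⇒x∉q p ⁅ y ⁆ x∈p-y (x∈⁅x⁆ y) }

∈∪⁅⁆⁻ : ∀ {n} {x v : Fin n} (R : Subset n) → x ∈ R ∪ ⁅ v ⁆ → x ∈ R ⊎ x ≡ v
∈∪⁅⁆⁻ {v = v} R x∈ with x∈p∪q⁻ R ⁅ v ⁆ x∈
... | inj₁ x∈R = inj₁ x∈R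
... | inj₂ x∈v = inj₂ (x∈⁅y⁆⇒x≡y v x∈v)

v∈∪⁅v⁆ : ∀ {n} (R : Subset n) (v : Fin n) → v ∈ R ∪ ⁅ v ⁆
v∈∪⁅v⁆ R v = x∈p∪q⁺ (inj₂ (x∈⁅x⁆ v))

adj-sym : ∀ {n} (G : Graph n) {u v : Fin n} → Adj G u v → Adj G v u
adj-sym G {u} {v} a = trans (sym (symm G u v)) a

adj? : ∀ {n} (G : Graph n) (u v : Fin n) → Dec (Adj G u v)
adj? G u v = adj G u v ≟ᵇ true

module Shelling {n : ℕ} (G : Graph n) where

  data ShellPath : Subset n → List (Fin n) → Subset n → Set where
    stay   : ∀ {R} → ShellPath R [] R
    delete : ∀ {R v vs R'} → SimplicialIn G R v →
             ShellPath (R ∪ ⁅ v ⁆) vs R' → ShellPath R (v ∷ vs) R'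

  _++ₚ_ : ∀ {R R' R'' fs gs} → ShellPath R fs R' → ShellPath R' gs R'' →
          ShellPath R (fs ++ gs) R''
  stay       ++ₚ q = q
  delete s p ++ₚ q = delete s (p ++ₚ q)

  toShellFrom : ∀ {R R' fs} → ShellPath R fs R' → ShellFrom G R fs
  toShellFrom stay         = done
  toShellFrom (delete s p) = step s (toShellFrom p)

  path-grows : ∀ {R R' fs} → ShellPath R fs R' → R ⊆ R'
  path-grows stay         x∈R = x∈R
  path-grows (delete s p) x∈R = path-grows p (p⊆p∪q _ x∈R)

  path-deletes : ∀ {R R' fs x} → ShellPath R fs R' → x List.∈ fs → x ∈ R'
  path-deletes {R} (delete {v = v} s p) (here refl) = path-grows p (v∈∪⁅v⁆ R v)
  path-deletes (delete s p) (there x∈fs) = path-deletes p x∈fs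

  path-only : ∀ {R R' fs x} → ShellPath R fs R' → x ∈ R' → x ∈ R ⊎ x List.∈ fs
  path-only stay x∈R = inj₁ x∈R
  path-only {R} (delete s p) x∈R' with path-only p x∈R'
  ... | inj₂ x∈fs = inj₂ (there x∈fs)
  ... | inj₁ x∈R∪v with ∈∪⁅⁆⁻ R x∈R∪v
  ...   | inj₁ x∈R  = inj₁ x∈R
  ...   | inj₂ refl = inj₂ (here refl)

  path-feasible : ∀ {F fs} → ShellPath ⊥ fs F → Feasible G F
  path-feasible {F} {fs} p = fs , toShellFrom p , λ x → mk⇔ (in-order x) (path-deletes p)
    where
    in-order : ∀ x → x ∈ F → x List.∈ fs
    in-order x x∈F with path-only p x∈F
    ... | inj₁ x∈∅  = ⊥-elim (∉⊥ x∈∅)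
    ... | inj₂ x∈fs = x∈fs

  record ShellsOut (R₀ : Subset n) (Q : Fin n → Set) : Set where
    field
      reached  : Subset n
      order    : List (Fin n)
      path     : ShellPath R₀ order reached
      only     : ∀ x → x ∈ reached → x ∈ R₀ ⊎ Q x
      every    : ∀ x → Q x → x ∈ reached

  module _ (R₀ : Subset n) (Q : Fin n → Set) (Q? : Decidable Q)
           (simplicial : ∀ {S v} → R₀ ⊆ S → Q v → v ∉ S → SimplicialIn G S v) where

    Listed : Subset n → List (Fin n) → Set
    Listed R cs = ∃[ R' ] ∃[ fs ] ShellPath R fs R' × (∀ x → x ∈ R' → x ∈ R₀ ⊎ Q x)
                                × (∀ x → Q x → x List.∈ cs → x ∈ R')

    shellHead : ∀ {c cs R} → R₀ ⊆ R → Q c → c ∉ R → Listed (R ∪ ⁅ c ⁆) cs → Listed R (c ∷ cs)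
    shellHead {c} {cs} {R} R₀⊆R qc c∉R (R' , fs , p , only , listed) =
      R' , c ∷ fs , delete (simplicial R₀⊆R qc c∉R) p , only , listed′
      where
      listed′ : ∀ x → Q x → x List.∈ c ∷ cs → x ∈ R'
      listed′ x _  (here refl)  = path-grows p (v∈∪⁅v⁆ R c)
      listed′ x qx (there x∈cs) = listed x qx x∈cs

    skipHead : ∀ {c cs R} → (Q c → c ∈ R) → Listed R cs → Listed R (c ∷ cs)
    skipHead {c} c-deleted (R' , fs , p , only , listed) = R' , fs , p , only , listed′
      where
      listed′ : ∀ x → Q x → x List.∈ c ∷ _ → x ∈ R'
      listed′ x qx (here refl)  = path-grows p (c-deleted qx)
      listed′ x qx (there x∈cs) = listed x qx x∈cs

    shellListed : ∀ cs R → R₀ ⊆ R → (∀ x → x ∈ R → x ∈ R₀ ⊎ Q x) → Listed R cs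
    shellListed [] R _ only = R , [] , stay , only , λ _ _ ()
    shellListed (c ∷ cs) R R₀⊆R only with c ∈? R | Q? c
    ... | yes c∈R | _      = skipHead (λ _ → c∈R) (shellListed cs R R₀⊆R only)
    ... | no _    | no ¬qc = skipHead (λ qc → ⊥-elim (¬qc qc)) (shellListed cs R R₀⊆R only)
    ... | no c∉R  | yes qc =
      shellHead R₀⊆R qc c∉R (shellListed cs (R ∪ ⁅ c ⁆) (λ x∈ → p⊆p∪q _ (R₀⊆R x∈)) only′)
      where
      only′ : ∀ x → x ∈ R ∪ ⁅ c ⁆ → x ∈ R₀ ⊎ Q x
      only′ x x∈ with ∈∪⁅⁆⁻ R x∈
      ... | inj₁ x∈R  = only x x∈R
      ... | inj₂ refl = inj₂ qc

    shellAll : ShellsOut R₀ Q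
    shellAll with shellListed (allFin n) R₀ (λ x∈ → x∈) (λ _ → inj₁)
    ... | R' , fs , p , only , listed =
      record { reached = R' ; order = fs ; path = p ; only = only
             ; every = λ x qx → listed x qx (∈-allFin x) }

  firstWith : (P : Fin n → Set) → Decidable P → ∀ {R fs w} → ShellFrom G R fs →
    P w → w List.∈ fs →
    ∃[ v ] ∃[ S ] P v × SimplicialIn G S v × (∀ y → y ∈ S → y ∈ R ⊎ (y List.∈ fs × ¬ P y))
  firstWith P P? done _ ()
  firstWith P P? {R} (step {v = v} s rest) pw w∈fs with P? v | w∈fs
  ... | yes pv | _           = v , R , pv , s , λ _ y∈R → inj₁ y∈R
  ... | no ¬pv | here refl   = ⊥-elim (¬pv pw)
  ... | no ¬pv | there w∈vs with firstWith P P? rest pw w∈vs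
  ...   | u , S , pu , su , before = u , S , pu , su , before′
    where
    before′ : ∀ y → y ∈ S → y ∈ R ⊎ (y List.∈ v ∷ _ × ¬ P y)
    before′ y y∈S with before y y∈S
    ... | inj₂ (y∈vs , ¬py) = inj₂ (there y∈vs , ¬py)
    ... | inj₁ y∈R∪v with ∈∪⁅⁆⁻ R y∈R∪v
    ...   | inj₁ y∈R  = inj₁ y∈R
    ...   | inj₂ refl = inj₂ (here refl , ¬pv)

  earlyWitness : ∀ {X} → Free G X → (P : Fin n → Set) → Decidable P →
    ∀ {x₀} → x₀ ∈ X → P x₀ →
    ∃[ v ] ∃[ S ] P v × SimplicialIn G S v × (∀ y → y ∈ X ⊎ P y → y ∉ S)
  earlyWitness {X} free P P? {x₀} x₀∈X px₀ = fromSeparating (free ⁅ x₀ ⁆ ⁅x₀⁆⊆X)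
    where
    ⁅x₀⁆⊆X : ⁅ x₀ ⁆ ⊆ X
    ⁅x₀⁆⊆X x∈ = subst (_∈ X) (sym (x∈⁅y⁆⇒x≡y x₀ x∈)) x₀∈X

    -- Shell a feasible F with F ∩ X = {x₀} up to its first P-vertex.
    fromSeparating : ∃[ F ] (Feasible G F × F ∩ X ≡ ⁅ x₀ ⁆) →
      ∃[ v ] ∃[ S ] P v × SimplicialIn G S v × (∀ y → y ∈ X ⊎ P y → y ∉ S)
    fromSeparating (F , (fs , shell , F⇔fs) , F∩X≡x₀)
      with firstWith P P? shell px₀ (Equivalence.to (F⇔fs x₀) x₀∈F)
      where
      x₀∈F : x₀ ∈ F
      x₀∈F = proj₁ (x∈p∩q⁻ F X (subst (x₀ ∈_) (sym F∩X≡x₀) (x∈⁅x⁆ x₀)))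
    ... | v , S , pv , sv , before = v , S , pv , sv , spared
      where
      spared : ∀ y → y ∈ X ⊎ P y → y ∉ S
      spared y kept y∈S with before y y∈S | kept
      ... | inj₁ y∈∅         | _       = ∉⊥ y∈∅
      ... | inj₂ (_ , ¬py)   | inj₂ py = ¬py py
      ... | inj₂ (y∈fs , ¬py) | inj₁ y∈X =
        ¬py (subst P (sym y≡x₀) px₀)
        where
        y≡x₀ : y ≡ x₀
        y≡x₀ = x∈⁅y⁆⇒x≡y x₀
          (subst (y ∈_) F∩X≡x₀ (x∈p∩q⁺ (Equivalence.from (F⇔fs y) y∈fs , y∈X)))

module Split {n : ℕ} {G : Graph n} {K I : Subset n} (split : IsSplit G K I) where
  open IsSplit split

  K-I-distinct : ∀ {x y} → x ∈ K → y ∈ I → x ≢ y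
  K-I-distinct {x} x∈K y∈I refl = disjoint x x∈K y∈I

  I-neighbour∈K : ∀ {x j} → j ∈ I → Adj G x j → x ∈ K
  I-neighbour∈K {x} {j} j∈I x~j with cover x
  ... | inj₁ x∈K = x∈K
  ... | inj₂ x∈I = ⊥-elim (indep x j x∈I j∈I x~j)

  K-neighbours⇒simplicial : ∀ {R v} → v ∉ R →
    (∀ u → u ∉ R → Adj G v u → u ∈ K) → SimplicialIn G R v
  K-neighbours⇒simplicial v∉R inK =
    v∉R , λ u w u∉R w∉R u≢w v~u v~w → clique u w (inK u u∉R v~u) (inK w w∉R v~w) u≢w

  I-simplicial : ∀ {R v} → v ∈ I → v ∉ R → SimplicialIn G R v
  I-simplicial v∈I v∉R =
    K-neighbours⇒simplicial v∉R (λ u _ v~u → I-neighbour∈K v∈I (adj-sym G v~u))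

module FreeSets {n : ℕ} (G : Graph n) (K I L J : Subset n)
                (split : IsSplit G K I) (L⊆K : L ⊆ K) (J⊆I : J ⊆ I) where
  open IsSplit split
  open Split split
  open Shelling G

  X : Subset n
  X = L ∪ J

  L⊆X : L ⊆ X
  L⊆X x∈L = x∈p∪q⁺ (inj₁ x∈L)

  J⊆X : J ⊆ X
  J⊆X x∈J = x∈p∪q⁺ (inj₂ x∈J)

  Adj⇒InNv : ∀ {h x} → x ≢ h → Adj G x h → InNv G h x
  Adj⇒InNv {h} x≢h x~h = x≢y⇒x∉⁅y⁆ x≢h , h , x∈⁅x⁆ h , x~h

  InNv⇒Adj : ∀ {h x} → InNv G h x → Adj G x h
  InNv⇒Adj {h} (_ , s , s∈h , x~s) = subst (Adj G _) (x∈⁅y⁆⇒x≡y h s∈h) x~s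

  K-vertex∈N[J-h] : ∀ {h v j} → v ∈ K → j ∈ J → j ≢ h → Adj G v j → InN G (J - h) v
  K-vertex∈N[J-h] {h} v∈K j∈J j≢h v~j =
    (λ v∈J-h → disjoint _ v∈K (J⊆I (proj₁ (x∈p-y⁻ J v∈J-h)))) ,
    _ , x∈p∧x≢y⇒x∈p-y j∈J j≢h , v~j

  module Necessity (free : Free G X) where

    single-J-neighbour : ∀ {l j j′} → l ∈ L → j ∈ J → j′ ∈ J → j ≢ j′ →
      Adj G l j → ¬ Adj G l j′
    single-J-neighbour {l} {j} {j′} l∈L j∈J j′∈J j≢j′ l~j l~j′
      with earlyWitness free (_≡ l) (_≟ l) (L⊆X l∈L) refl
    ... | .l , S , refl , (_ , simplicial) , spared =
      indep j j′ (J⊆I j∈J) (J⊆I j′∈J)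
        (simplicial j j′ (spared j (inj₁ (J⊆X j∈J))) (spared j′ (inj₁ (J⊆X j′∈J))) j≢j′ l~j l~j′)

    module _ {l₀ h} (l₀∈L : l₀ ∈ L) (h∈J : h ∈ J) (l₀~h : Adj G l₀ h) where

      -- L ⊆ N(h): shell l₀ while x and h are present.
      L-sees-h : ∀ {x} → x ∈ L → Adj G x h
      L-sees-h {x} x∈L with x ≟ l₀
      ... | yes refl = l₀~h
      ... | no x≢l₀ with earlyWitness free (_≡ l₀) (_≟ l₀) (L⊆X l₀∈L) refl
      ...   | .l₀ , S , refl , (_ , simplicial) , spared =
        simplicial x h (spared x (inj₁ (L⊆X x∈L))) (spared h (inj₁ (J⊆X h∈J)))
          (K-I-distinct (L⊆K x∈L) (J⊆I h∈J))
          (clique l₀ x (L⊆K l₀∈L) (L⊆K x∈L) (λ l₀≡x → x≢l₀ (sym l₀≡x))) l₀~h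

      -- A neighbour of J ∖ h is not in L, as it would see h as well.
      N[J-h]∩L≡∅ : ∀ {x j} → j ∈ J → j ≢ h → Adj G x j → x ∉ L
      N[J-h]∩L≡∅ j∈J j≢h x~j x∈L =
        single-J-neighbour x∈L h∈J j∈J (λ h≡j → j≢h (sym h≡j)) (L-sees-h x∈L) x~j

      -- A neighbour x of J ∖ h sees h: of l₀ and x, whichever is shelled
      -- first has its two other neighbours adjacent, and l₀ ≁ j.
      N[J-h]-sees-h : ∀ {x j} → j ∈ J → j ≢ h → Adj G x j → Adj G x h
      N[J-h]-sees-h {x} {j} j∈J j≢h x~j =
        firstShelled (earlyWitness free (λ y → y ≡ l₀ ⊎ y ≡ x) (λ y → (y ≟ l₀) ⊎-dec (y ≟ x))
                                   (L⊆X l₀∈L) (inj₁ refl))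
        where
        x∈K : x ∈ K
        x∈K = I-neighbour∈K (J⊆I j∈J) x~j

        l₀≢x : l₀ ≢ x
        l₀≢x l₀≡x = N[J-h]∩L≡∅ j∈J j≢h x~j (subst (_∈ L) l₀≡x l₀∈L)

        firstShelled : ∃[ v ] ∃[ S ] (v ≡ l₀ ⊎ v ≡ x) × SimplicialIn G S v
                         × (∀ y → y ∈ X ⊎ (y ≡ l₀ ⊎ y ≡ x) → y ∉ S) → Adj G x h
        firstShelled (_ , S , inj₁ refl , (_ , simplicial) , spared) =
          simplicial x h (spared x (inj₂ (inj₂ refl))) (spared h (inj₁ (J⊆X h∈J)))
            (K-I-distinct x∈K (J⊆I h∈J)) (clique l₀ x (L⊆K l₀∈L) x∈K l₀≢x) l₀~h
        firstShelled (_ , S , inj₂ refl , (_ , simplicial) , spared) =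
          ⊥-elim (single-J-neighbour l₀∈L h∈J j∈J (λ h≡j → j≢h (sym h≡j)) l₀~h
            (adj-sym G (simplicial j l₀ (spared j (inj₁ (J⊆X j∈J))) (spared l₀ (inj₂ (inj₁ refl)))
              (λ j≡l₀ → K-I-distinct (L⊆K l₀∈L) (J⊆I j∈J) (sym j≡l₀)) x~j
              (clique x l₀ x∈K (L⊆K l₀∈L) (λ x≡l₀ → l₀≢x (sym x≡l₀))))))

      good : GoodVertex G L J
      good = h , h∈J
           , (λ x x∈L → Adj⇒InNv (K-I-distinct (L⊆K x∈L) (J⊆I h∈J)) (L-sees-h x∈L))
           , λ { x (_ , j , j∈J-h , x~j) →
                 let (j∈J , j≢h) = x∈p-y⁻ J j∈J-h in
                 Adj⇒InNv (K-I-distinct (I-neighbour∈K (J⊆I j∈J) x~j) (J⊆I h∈J))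
                          (N[J-h]-sees-h j∈J j≢h x~j)
               , N[J-h]∩L≡∅ j∈J j≢h x~j }

    necessity : NoEdgeBetween G L J ⊎ GoodVertex G L J
    necessity with any? (λ l → any? (λ j → (l ∈? L) ×-dec (j ∈? J) ×-dec adj? G l j))
    ... | yes (l , j , l∈L , j∈J , l~j) = inj₂ (good l∈L j∈J l~j)
    ... | no no-edge = inj₁ (λ l j l∈L j∈J l~j → no-edge (l , j , l∈L , j∈J , l~j))

  module Sufficiency (Y : Subset n) (Y⊆X : Y ⊆ X) where

    Realised : Set
    Realised = ∃[ F ] (Feasible G F × F ∩ X ≡ Y)

    Round₁ : Fin n → Set
    Round₁ x = x ∈ I × (x ∉ J ⊎ x ∈ Y)

    Round₃ : Fin n → Set
    Round₃ x = x ∈ L × x ∈ Y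

    survivor : ∀ {S u} → (∀ x → Round₁ x → x ∈ S) → u ∈ I → u ∉ S → u ∈ J × u ∉ Y
    survivor {S} {u} round₁⊆S u∈I u∉S with u ∈? J | u ∈? Y
    ... | _      | yes u∈Y = ⊥-elim (u∉S (round₁⊆S u (u∈I , inj₂ u∈Y)))
    ... | no u∉J | no _    = ⊥-elim (u∉S (round₁⊆S u (u∈I , inj₁ u∉J)))
    ... | yes u∈J | no u∉Y = u∈J , u∉Y

    realise : (Round₂ : Fin n → Set) → Decidable Round₂ →
      (∀ {x} → Round₂ x → x ∈ K × x ∉ L) →
      (∀ {S v} → (∀ x → Round₁ x → x ∈ S) → Round₂ v → v ∉ S → SimplicialIn G S v) →
      (∀ {S v} → (∀ x → Round₁ x → x ∈ S) → (∀ x → Round₂ x → x ∈ S) →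
         Round₃ v → v ∉ S → SimplicialIn G S v) →
      Realised
    realise Round₂ Round₂? Round₂⊆K∖L simplicial₂ simplicial₃ =
      F , path-feasible (path₁ ++ₚ (path₂ ++ₚ path₃)) , ⊆-antisym F∩X⊆Y Y⊆F∩X
      where
      round₁ : ShellsOut ⊥ Round₁
      round₁ = shellAll ⊥ Round₁ (λ x → (x ∈? I) ×-dec (¬? (x ∈? J) ⊎-dec (x ∈? Y)))
                 (λ _ (v∈I , _) v∉S → I-simplicial v∈I v∉S)
      open ShellsOut round₁ renaming (reached to R₁; path to path₁; only to only₁; every to every₁)

      round₂ : ShellsOut R₁ Round₂
      round₂ = shellAll R₁ Round₂ Round₂? (λ R₁⊆S → simplicial₂ (λ x q → R₁⊆S (every₁ x q)))
      open ShellsOut round₂ renaming (reached to R₂; path to path₂; only to only₂; every to every₂)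

      round₃ : ShellsOut R₂ Round₃
      round₃ = shellAll R₂ Round₃ (λ x → (x ∈? L) ×-dec (x ∈? Y))
                 (λ R₂⊆S → simplicial₃ (λ x q → R₂⊆S (path-grows path₂ (every₁ x q)))
                                       (λ x q → R₂⊆S (every₂ x q)))
      open ShellsOut round₃ renaming (reached to F; path to path₃; only to only₃; every to every₃)

      shed : ∀ {x} → x ∈ F → Round₁ x ⊎ Round₂ x ⊎ Round₃ x
      shed {x} x∈F with only₃ x x∈F
      ... | inj₂ r₃ = inj₂ (inj₂ r₃)
      ... | inj₁ x∈R₂ with only₂ x x∈R₂
      ...   | inj₂ r₂ = inj₂ (inj₁ r₂)
      ...   | inj₁ x∈R₁ with only₁ x x∈R₁
      ...     | inj₂ r₁ = inj₁ r₁
      ...     | inj₁ x∈∅ = ⊥-elim (∉⊥ x∈∅)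

      F∩X⊆Y : F ∩ X ⊆ Y
      F∩X⊆Y {x} x∈F∩X with x∈p∩q⁻ F X x∈F∩X
      ... | x∈F , x∈X with shed x∈F | x∈p∪q⁻ L J x∈X
      ... | inj₁ (_ , inj₂ x∈Y)     | _        = x∈Y
      ... | inj₁ (_ , inj₁ x∉J)     | inj₂ x∈J = ⊥-elim (x∉J x∈J)
      ... | inj₁ (x∈I , inj₁ _)     | inj₁ x∈L = ⊥-elim (disjoint x (L⊆K x∈L) x∈I)
      ... | inj₂ (inj₁ r₂)          | inj₁ x∈L = ⊥-elim (proj₂ (Round₂⊆K∖L r₂) x∈L)
      ... | inj₂ (inj₁ r₂)          | inj₂ x∈J = ⊥-elim (disjoint x (proj₁ (Round₂⊆K∖L r₂)) (J⊆I x∈J))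
      ... | inj₂ (inj₂ (_ , x∈Y))   | _        = x∈Y

      Y⊆F : Y ⊆ F
      Y⊆F {x} x∈Y with x∈p∪q⁻ L J (Y⊆X x∈Y)
      ... | inj₁ x∈L = every₃ x (x∈L , x∈Y)
      ... | inj₂ x∈J = path-grows path₃ (path-grows path₂ (every₁ x (J⊆I x∈J , inj₂ x∈Y)))

      Y⊆F∩X : Y ⊆ F ∩ X
      Y⊆F∩X x∈Y = x∈p∩q⁺ (Y⊆F x∈Y , Y⊆X x∈Y)

    -- If no vertex of L sees a vertex of J ∖ Y, round two can be empty: the
    -- surviving neighbours of a vertex of L all lie in K.
    realise-without-middle : (∀ {l u} → l ∈ L → u ∈ J → u ∉ Y → ¬ Adj G l u) → Realised
    realise-without-middle no-edge =
      realise (λ _ → Empty) (λ _ → no λ ()) (λ ()) (λ _ ()) simplicial₃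
      where
      simplicial₃ : ∀ {S v} → (∀ x → Round₁ x → x ∈ S) → (∀ x → Empty → x ∈ S) →
        Round₃ v → v ∉ S → SimplicialIn G S v
      simplicial₃ {S} {v} round₁⊆S _ (v∈L , _) v∉S = K-neighbours⇒simplicial v∉S inK
        where
        inK : ∀ u → u ∉ S → Adj G v u → u ∈ K
        inK u u∉S v~u with cover u
        ... | inj₁ u∈K = u∈K
        ... | inj₂ u∈I = let (u∈J , u∉Y) = survivor round₁⊆S u∈I u∉S in
                         ⊥-elim (no-edge v∈L u∈J u∉Y v~u)

    module WithGoodVertex {h : Fin n} (L⊆N[h] : ∀ x → x ∈ L → InNv G h x)
      (N[J-h]⊆N[h]∖L : ∀ x → InN G (J - h) x → InNv G h x × x ∉ L) where

      sees-J-h : ∀ {v u} → v ∈ K → u ∈ J → u ≢ h → Adj G v u → Adj G v h × v ∉ L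
      sees-J-h v∈K u∈J u≢h v~u with N[J-h]⊆N[h]∖L _ (K-vertex∈N[J-h] v∈K u∈J u≢h v~u)
      ... | v∈N[h] , v∉L = InNv⇒Adj v∈N[h] , v∉L

      -- Round two sheds the K-vertices not adjacent to h.  Afterwards the
      -- surviving neighbours of a vertex of L lie in the clique formed by h
      -- and the remaining K-vertices.
      Round₂ : Fin n → Set
      Round₂ x = x ∈ K × ¬ Adj G x h

      I-neighbour : ∀ {S v u} → (∀ x → Round₁ x → x ∈ S) → v ∈ K → u ∈ I → u ∉ S →
        Adj G v u → u ≡ h ⊎ (Adj G v h × v ∉ L)
      I-neighbour round₁⊆S v∈K u∈I u∉S v~u with survivor round₁⊆S u∈I u∉S
      ... | u∈J , _ with _ ≟ h
      ...   | yes u≡h = inj₁ u≡h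
      ...   | no u≢h  = inj₂ (sees-J-h v∈K u∈J u≢h v~u)

      -- A vertex shed in round two has only K-vertices as surviving neighbours.
      simplicial₂ : ∀ {S v} → (∀ x → Round₁ x → x ∈ S) → Round₂ v → v ∉ S → SimplicialIn G S v
      simplicial₂ {S} {v} round₁⊆S (v∈K , v≁h) v∉S = K-neighbours⇒simplicial v∉S inK
        where
        inK : ∀ u → u ∉ S → Adj G v u → u ∈ K
        inK u u∉S v~u with cover u
        ... | inj₁ u∈K = u∈K
        ... | inj₂ u∈I with I-neighbour round₁⊆S v∈K u∈I u∉S v~u
        ...   | inj₁ refl       = ⊥-elim (v≁h v~u)
        ...   | inj₂ (v~h , _)  = ⊥-elim (v≁h v~h)

      -- The surviving neighbours of a vertex of L lie in K ∪ {h}, and the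
      -- surviving K-vertices see h.
      simplicial₃ : ∀ {S v} → (∀ x → Round₁ x → x ∈ S) → (∀ x → Round₂ x → x ∈ S) →
        Round₃ v → v ∉ S → SimplicialIn G S v
      simplicial₃ {S} {v} round₁⊆S round₂⊆S (v∈L , _) v∉S = v∉S , adjacent
        where
        neighbour : ∀ u → u ∉ S → Adj G v u → u ∈ K ⊎ u ≡ h
        neighbour u u∉S v~u with cover u
        ... | inj₁ u∈K = inj₁ u∈K
        ... | inj₂ u∈I with I-neighbour round₁⊆S (L⊆K v∈L) u∈I u∉S v~u
        ...   | inj₁ u≡h       = inj₂ u≡h
        ...   | inj₂ (_ , v∉L) = ⊥-elim (v∉L v∈L)

        K-sees-h : ∀ u → u ∈ K → u ∉ S → Adj G u h
        K-sees-h u u∈K u∉S = decidable-stable (adj? G u h) (λ u≁h → u∉S (round₂⊆S u (u∈K , u≁h)))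

        adjacent : ∀ u w → u ∉ S → w ∉ S → u ≢ w → Adj G v u → Adj G v w → Adj G u w
        adjacent u w u∉S w∉S u≢w v~u v~w with neighbour u u∉S v~u | neighbour w w∉S v~w
        ... | inj₁ u∈K  | inj₁ w∈K  = clique u w u∈K w∈K u≢w
        ... | inj₁ u∈K  | inj₂ refl = K-sees-h u u∈K u∉S
        ... | inj₂ refl | inj₁ w∈K  = adj-sym G (K-sees-h w w∈K w∉S)
        ... | inj₂ refl | inj₂ refl = ⊥-elim (u≢w refl)

      -- Round two sheds only vertices of K ∖ L, as L ⊆ N(h).
      realise-with-good : Realised
      realise-with-good = realise Round₂ (λ x → (x ∈? K) ×-dec ¬? (adj? G x h))
        (λ { (x∈K , x≁h) → x∈K , λ x∈L → x≁h (InNv⇒Adj (L⊆N[h] _ x∈L)) })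
        simplicial₂ simplicial₃

    sufficiency : NoEdgeBetween G L J ⊎ GoodVertex G L J → Realised
    sufficiency (inj₁ no-edge) = realise-without-middle λ l∈L u∈J _ → no-edge _ _ l∈L u∈J
    sufficiency (inj₂ (h , _ , L⊆N[h] , N[J-h]⊆N[h]∖L)) =
      WithGoodVertex.realise-with-good L⊆N[h] N[J-h]⊆N[h]∖L

mainTheorem15 : ∀ (n : ℕ) (G : Graph n) (K I L J : Subset n) →
    IsSplit G K I → L ⊆ K → J ⊆ I →
    Free G (L ∪ J) ⇔ (NoEdgeBetween G L J ⊎ GoodVertex G L J)
mainTheorem15 n G K I L J split L⊆K J⊆I =
  mk⇔ Necessity.necessity (λ condition Y Y⊆X → Sufficiency.sufficiency Y Y⊆X condition)
  where
  open FreeSets G K I L J split L⊆K J⊆I
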